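{- For every simply typed $\lambda$-term $M$: (1) $\lfloor *;M^{\mathrm n}\rfloor=\lfloor\widehat M^{\mathrm n}\rfloor=\lfloor M^{\mathrm n}\rfloor=M$; (2) $\lfloor M^{\mathrm v}\,*\rfloor=\lfloor\widehat M^{\mathrm v}\rfloor=\lfloor M^{\mathrm v}\rfloor=M$.
   Context: ptq-calculus: p-variables (identified with $\lambda$-variables), a t-variable $k$, a constant $*$; p-terms $p::=x\mid\lambda\langle x,k\rangle.u\mid\lambda k.u$; t-terms $t::=*\mid k\mid\langle p,t\rangle\mid\lambda x.u$; q-terms $q::=\overline{\lambda}k.u$; e-terms $u::=t;p\mid q\,t$; binders $\lambda\langle x,k\rangle$ (binds $x,k$), $\lambda k,\overline\lambda k$ (bind $k$), $\lambda x$ (binds $x$); terms modulo $\alpha$-conversion. For $u$ with $k$ free, $u_*:=u[*/k]$. Composition: $t_*\cdot a_*:=a_*[t_*/*]$. $\Lambda_\Box$-terms: $\lambda$-terms that may contain a constant $\Box$; $M\cdot N:=M[N/\Box]$. Readback: $\lfloor *\rfloor=\Box$; $\lfloor x\rfloor=x$; $\lfloor\langle p,t_*\rangle\rfloor=\lfloor t_*\rfloor\cdot(\Box\,\lfloor p\rfloor)$; $\lfloor\lambda\langle x,k\rangle.u\rfloor=\lambda x.\lfloor u_*\rfloor$; $\lfloor\lambda x.u_*\rfloor=\lfloor u_*\rfloor[\Box/x]$; $\lfloor\lambda k.u\rfloor=\lfloor u_*\rfloor$; $\lfloor\overline\lambda k.u\rfloor=\lfloor u_*\rfloor$; $\lfloor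 t_*;p\rfloor=\lfloor t_*\rfloor\cdot\lfloor p\rfloor$; $\lfloor q\,t_*\rfloor=\lfloor t_*\rfloor\cdot\lfloor q\rfloor$. $\lambda$-terms: a value $V$ is a variable or an abstraction. Translations: $x^{\mathrm n}=x$, $(\lambda x.M)^{\mathrm n}=\lambda\langle x,k\rangle.k;M^{\mathrm n}$, $(MN)^{\mathrm n}=\lambda k.\langle N^{\mathrm n},k\rangle;M^{\mathrm n}$; $x^{\mathrm v}=\overline\lambda k.k;x$, $(\lambda x.M)^{\mathrm v}=\overline\lambda k.k;(\lambda\langle x,k\rangle.M^{\mathrm v}k)$, $(MN)^{\mathrm v}=\overline\lambda k.N^{\mathrm v}(\lambda x.M^{\mathrm v}\langle x,k\rangle)$. Auxiliary: $\overline{x}^{\mathrm n}=\overline x^{\mathrm v}=x$, $\overline{\lambda x.M}^{\mathrm n}=\lambda\langle x,k\rangle.k;M^{\mathrm n}$, $\overline{\lambda x.M}^{\mathrm v}=\lambda\langle x,k\rangle.M^{\mathrm v}k$. E-term translations: $\widehat V^{\mathrm n}=*;\overline V^{\mathrm n}$, $\widehat{MN}^{\mathrm n}=\langle N^{\mathrm n},*\rangle\cdot\widehat M^{\mathrm n}$; $\widehat V^{\mathrm v}=*;\overline V^{\mathrm v}$, $\widehat{MV}^{\mathrm v}=\langle\overline V^{\mathrm v},*\rangle\cdot\widehat M^{\mathrm v}$ ($V$ value), $\widehat{MN}^{\mathrm v}=(\lambda x.M^{\mathrm v}\langle x,*\rangle)\cdot\widehat N^{\mathrm v}$ ($N$ not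 a value, $x$ fresh). -}

module Defs where

open import Data.Nat using (ℕ; zero; suc; _<ᵇ_; _≡ᵇ_)
open import Data.Bool using (if_then_else_)
open import Data.List using (List; []; _∷_)
open import Data.Product using (∃; ∃-syntax; _×_)

-- λ-terms (de Bruijn indices; α-equivalence is syntactic equality)

data Λ : Set where
  var : ℕ → Λ
  lam : Λ → Λ
  app : Λ → Λ → Λ

data Value : Λ → Set where
  var : ∀ x → Value (var x)
  lam : ∀ M → Value (lam M)

data Ty : Set where
  atom : ℕ → Ty
  _⇒_  : Ty → Ty → Ty

Ctx : Set
Ctx = List Ty

data _∋_∶_ : Ctx → ℕ → Ty → Set where
  here  : ∀ {Γ A} → (A ∷ Γ) ∋ zero ∶ A
  there : ∀ {Γ A B n} → Γ ∋ n ∶ A → (B ∷ Γ) ∋ suc n ∶ A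

data _⊢_∶_ : Ctx → Λ → Ty → Set where
  ⊢var : ∀ {Γ x A} → Γ ∋ x ∶ A → Γ ⊢ var x ∶ A
  ⊢lam : ∀ {Γ M A B} → (A ∷ Γ) ⊢ M ∶ B → Γ ⊢ lam M ∶ (A ⇒ B)
  ⊢app : ∀ {Γ M N A B} → Γ ⊢ M ∶ (A ⇒ B) → Γ ⊢ N ∶ A → Γ ⊢ app M N ∶ B

SimplyTyped : Λ → Set
SimplyTyped M = ∃[ Γ ] ∃[ A ] (Γ ⊢ M ∶ A)

data Λ□ : Set where
  var : ℕ → Λ□
  lam : Λ□ → Λ□
  app : Λ□ → Λ□ → Λ□
  □   : Λ□

ι : Λ → Λ□
ι (var x)   = var x
ι (lam M)   = lam (ι M)
ι (app M N) = app (ι M) (ι N)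

shift□ : ℕ → Λ□ → Λ□
shift□ c (var n)   = if n <ᵇ c then var n else var (suc n)
shift□ c (lam M)   = lam (shift□ (suc c) M)
shift□ c (app M N) = app (shift□ c M) (shift□ c N)
shift□ c □         = □

-- M[N/□] (capture-avoiding: N is shifted under binders)
fill : Λ□ → Λ□ → Λ□
fill (var n)   N = var n
fill (lam M)   N = lam (fill M (shift□ zero N))
fill (app M P) N = app (fill M N) (fill P N)
fill □         N = N

_·□_ : Λ□ → Λ□ → Λ□
M ·□ N = fill M N

-- M[□/x] where x is the de Bruijn index c (the binder is removed,
-- so larger indices are decremented)
boxVar : ℕ → Λ□ → Λ□
boxVar c (var n)   = if n ≡ᵇ c then □ else (if n <ᵇ c then var n else var (pred n))
  where pred : ℕ → ℕ
        pred zero = zero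
        pred (suc m) = m
boxVar c (lam M)   = lam (boxVar (suc c) M)
boxVar c (app M N) = app (boxVar c M) (boxVar c N)
boxVar c □         = □

-- ptq-calculus.  p-variables are de Bruijn indices; there is a single
-- t-variable k, written `k`, which refers to the innermost enclosing
-- k-binder (λ⟨x,k⟩, λk or λ̄k).

mutual
  data P : Set where
    pv   : ℕ → P
    λxk  : E → P          -- binds x (index 0) and k
    λk   : E → P          -- binds k

  data T : Set where
    *    : T
    k    : T
    ⟨_,_⟩ : P → T → T
    λx   : E → T          -- binds x (index 0)

  data Q : Set where
    λ̄k  : E → Q          -- binds k

  data E : Set where
    _⨾_  : T → P → E
    _＠_ : Q → T → E

mutual
  shiftP : ℕ → P → P
  shiftP c (pv n)  = if n <ᵇ c then pv n else pv (suc n)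
  shiftP c (λxk u) = λxk (shiftE (suc c) u)
  shiftP c (λk u)  = λk (shiftE c u)

  shiftT : ℕ → T → T
  shiftT c *       = *
  shiftT c k       = k
  shiftT c ⟨ p , t ⟩ = ⟨ shiftP c p , shiftT c t ⟩
  shiftT c (λx u)  = λx (shiftE (suc c) u)

  shiftQ : ℕ → Q → Q
  shiftQ c (λ̄k u) = λ̄k (shiftE c u)

  shiftE : ℕ → E → E
  shiftE c (t ⨾ p) = shiftT c t ⨾ shiftP c p
  shiftE c (q ＠ t) = shiftQ c q ＠ shiftT c t

mutual
  kP : P → P
  kP (pv n)  = pv n
  kP (λxk u) = λxk u       -- k is bound here
  kP (λk u)  = λk u        -- k is bound here

  kT : T → T
  kT *         = *
  kT k         = *
  kT ⟨ p , t ⟩ = ⟨ kP p , kT t ⟩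
  kT (λx u)    = λx (kE u)

  kQ : Q → Q
  kQ (λ̄k u) = λ̄k u        -- k is bound here

  kE : E → E
  kE (t ⨾ p) = kT t ⨾ kP p
  kE (q ＠ t) = kQ q ＠ kT t

_₊ : E → E
u ₊ = kE u

mutual
  starP : T → P → P
  starP s (pv n)  = pv n
  starP s (λxk u) = λxk (starE (shiftT zero s) u)
  starP s (λk u)  = λk (starE s u)

  starT : T → T → T
  starT s *         = s
  starT s k         = k
  starT s ⟨ p , t ⟩ = ⟨ starP s p , starT s t ⟩
  starT s (λx u)    = λx (starE (shiftT zero s) u)

  starQ : T → Q → Q
  starQ s (λ̄k u) = λ̄k (starE s u)

  starE : T → E → E
  starE s (t ⨾ p) = starT s t ⨾ starP s p
  starE s (q ＠ t) = starQ s q ＠ starT s t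

_∙T_ : T → T → T
t ∙T a = starT t a

_∙E_ : T → E → E
t ∙E a = starE t a

-- Readback ⌊_⌋, given as the graph of the (partial, syntax-directed)
-- function of the paper.  It is defined exactly on terms without free k.

mutual
  data ⌊_⌋P⇓_ : P → Λ□ → Set where
    rb-var : ∀ {x} → ⌊ pv x ⌋P⇓ var x
    rb-λxk : ∀ {u U} → ⌊ u ₊ ⌋E⇓ U → ⌊ λxk u ⌋P⇓ lam U
    rb-λk  : ∀ {u U} → ⌊ u ₊ ⌋E⇓ U → ⌊ λk u ⌋P⇓ U

  data ⌊_⌋T⇓_ : T → Λ□ → Set where
    rb-*    : ⌊ * ⌋T⇓ □
    rb-pair : ∀ {p t P' T'} → ⌊ t ⌋T⇓ T' → ⌊ p ⌋P⇓ P' →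
              ⌊ ⟨ p , t ⟩ ⌋T⇓ (T' ·□ app □ P')
    rb-λx   : ∀ {u U} → ⌊ u ⌋E⇓ U → ⌊ λx u ⌋T⇓ boxVar zero U

  data ⌊_⌋Q⇓_ : Q → Λ□ → Set where
    rb-λ̄k : ∀ {u U} → ⌊ u ₊ ⌋E⇓ U → ⌊ λ̄k u ⌋Q⇓ U

  data ⌊_⌋E⇓_ : E → Λ□ → Set where
    rb-semi : ∀ {t p T' P'} → ⌊ t ⌋T⇓ T' → ⌊ p ⌋P⇓ P' → ⌊ t ⨾ p ⌋E⇓ (T' ·□ P')
    rb-app  : ∀ {q t Q' T'} → ⌊ t ⌋T⇓ T' → ⌊ q ⌋Q⇓ Q' → ⌊ q ＠ t ⌋E⇓ (T' ·□ Q')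

_ⁿ : Λ → P
var x ⁿ   = pv x
lam M ⁿ   = λxk (k ⨾ (M ⁿ))
app M N ⁿ = λk (⟨ N ⁿ , k ⟩ ⨾ (M ⁿ))

_ᵛ : Λ → Q
var x ᵛ   = λ̄k (k ⨾ pv x)
lam M ᵛ   = λ̄k (k ⨾ λxk ((M ᵛ) ＠ k))
app M N ᵛ = λ̄k ((N ᵛ) ＠ λx (shiftQ zero (M ᵛ) ＠ ⟨ pv zero , k ⟩))

barⁿ : (V : Λ) → Value V → P
barⁿ .(var x) (var x) = pv x
barⁿ .(lam M) (lam M) = λxk (k ⨾ (M ⁿ))

barᵛ : (V : Λ) → Value V → P
barᵛ .(var x) (var x) = pv x
barᵛ .(lam M) (lam M) = λxk ((M ᵛ) ＠ k)

hatⁿ : Λ → E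
hatⁿ (var x)   = * ⨾ barⁿ (var x) (var x)
hatⁿ (lam M)   = * ⨾ barⁿ (lam M) (lam M)
hatⁿ (app M N) = ⟨ N ⁿ , * ⟩ ∙E hatⁿ M

hatᵛ : Λ → E
hatᵛ (var x)   = * ⨾ barᵛ (var x) (var x)
hatᵛ (lam M)   = * ⨾ barᵛ (lam M) (lam M)
hatᵛ (app M (var x))   = ⟨ barᵛ (var x) (var x) , * ⟩ ∙E hatᵛ M
hatᵛ (app M (lam N))   = ⟨ barᵛ (lam N) (lam N) , * ⟩ ∙E hatᵛ M
hatᵛ (app M (app N₁ N₂)) =
  λx (shiftQ zero (M ᵛ) ＠ ⟨ pv zero , * ⟩) ∙E hatᵛ (app N₁ N₂)

-- Readback turns composition into □-filling, ⌊ s · a ⌋ = ⌊ s ⌋ · ⌊ a ⌋,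
-- as long as the * of a occurs once and outside every p- and q-term, and
-- it commutes with shifting p-variables.  The two translations and the two
-- e-term translations are assembled from such compositions, so their
-- readbacks follow by induction on M from the substitution algebra of
-- fill, shift□ and boxVar.
module Submission where

open import Defs
open import Data.Bool using (true; false)
open import Data.Bool.Properties using (T-≡)
open import Data.Nat using (zero; suc; _<_; _≤_; z≤n; s≤s; _<ᵇ_; _≡ᵇ_)
open import Data.Nat.Properties
  using (≤-trans; m≤n⇒m≤1+n; ≮⇒≥; <⇒≢; >⇒≢; <-cmp; _<?_; ≡⇒≡ᵇ)
open import Data.Product using (_×_; _,_)
open import Function using (_∘_)
open import Function.Bundles using (module Equivalence)
open import Relation.Binary.Definitions using (tri<; tri≈; tri>)
open import Relation.Binary.PropositionalEquality
open import Relation.Nullary using (yes; no; contradiction)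

<⇒<ᵇ≡true : ∀ {m n} → m < n → (m <ᵇ n) ≡ true
<⇒<ᵇ≡true {zero}  (s≤s _)   = refl
<⇒<ᵇ≡true {suc m} (s≤s m<n) = <⇒<ᵇ≡true m<n

≤⇒<ᵇ≡false : ∀ {m n} → n ≤ m → (m <ᵇ n) ≡ false
≤⇒<ᵇ≡false z≤n       = refl
≤⇒<ᵇ≡false (s≤s n≤m) = ≤⇒<ᵇ≡false n≤m

≢⇒≡ᵇ≡false : ∀ {m n} → m ≢ n → (m ≡ᵇ n) ≡ false
≢⇒≡ᵇ≡false {zero}  {zero}  m≢n = contradiction refl m≢n
≢⇒≡ᵇ≡false {zero}  {suc n} _   = refl
≢⇒≡ᵇ≡false {suc m} {zero}  _   = refl
≢⇒≡ᵇ≡false {suc m} {suc n} m≢n = ≢⇒≡ᵇ≡false (m≢n ∘ cong suc)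

shift□-var-< : ∀ {n c} → n < c → shift□ c (var n) ≡ var n
shift□-var-< n<c rewrite <⇒<ᵇ≡true n<c = refl

shift□-var-≥ : ∀ {n c} → c ≤ n → shift□ c (var n) ≡ var (suc n)
shift□-var-≥ c≤n rewrite ≤⇒<ᵇ≡false c≤n = refl

boxVar-var-< : ∀ {n c} → n < c → boxVar c (var n) ≡ var n
boxVar-var-< n<c rewrite ≢⇒≡ᵇ≡false (<⇒≢ n<c) | <⇒<ᵇ≡true n<c = refl

boxVar-var-≡ : ∀ c → boxVar c (var c) ≡ □
boxVar-var-≡ c rewrite Equivalence.to T-≡ (≡⇒≡ᵇ c c refl) = refl

boxVar-var-> : ∀ {m c} → c ≤ m → boxVar c (var (suc m)) ≡ var m
boxVar-var-> c≤m
  rewrite ≢⇒≡ᵇ≡false (>⇒≢ (s≤s c≤m)) | ≤⇒<ᵇ≡false (m≤n⇒m≤1+n c≤m) = refl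

fill-ι : ∀ M X → fill (ι M) X ≡ ι M
fill-ι (var x)   X = refl
fill-ι (lam M)   X = cong lam (fill-ι M (shift□ zero X))
fill-ι (app M N) X = cong₂ app (fill-ι M X) (fill-ι N X)

fill-identityʳ : ∀ S → fill S □ ≡ S
fill-identityʳ (var x)   = refl
fill-identityʳ (lam S)   = cong lam (fill-identityʳ S)
fill-identityʳ (app S T) = cong₂ app (fill-identityʳ S) (fill-identityʳ T)
fill-identityʳ □         = refl

shift□-shift□ : ∀ d c B → d ≤ c → shift□ (suc c) (shift□ d B) ≡ shift□ d (shift□ c B)
shift□-shift□ d c (var n) d≤c with n <? d | n <? c
... | yes n<d | _
  rewrite shift□-var-< (≤-trans n<d d≤c) | shift□-var-< n<d
        | shift□-var-< (≤-trans n<d (m≤n⇒m≤1+n d≤c)) = refl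
... | no n≮d | yes n<c
  rewrite shift□-var-< n<c | shift□-var-≥ (≮⇒≥ n≮d) | shift□-var-< (s≤s n<c) = refl
... | no n≮d | no n≮c
  rewrite shift□-var-≥ (≮⇒≥ n≮c) | shift□-var-≥ (≮⇒≥ n≮d)
        | shift□-var-≥ (s≤s (≮⇒≥ n≮c))
        | shift□-var-≥ (m≤n⇒m≤1+n (≮⇒≥ n≮d)) = refl
shift□-shift□ d c (lam B)   d≤c = cong lam (shift□-shift□ (suc d) (suc c) B (s≤s d≤c))
shift□-shift□ d c (app B C) d≤c =
  cong₂ app (shift□-shift□ d c B d≤c) (shift□-shift□ d c C d≤c)
shift□-shift□ d c □         d≤c = refl

shift□-fill : ∀ c A B → shift□ c (fill A B) ≡ fill (shift□ c A) (shift□ c B)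
shift□-fill c (var n) B with n <ᵇ c
... | true  = refl
... | false = refl
shift□-fill c (lam A) B =
  cong lam (trans (shift□-fill (suc c) A (shift□ zero B))
                  (cong (fill (shift□ (suc c) A)) (shift□-shift□ zero c B z≤n)))
shift□-fill c (app A C) B = cong₂ app (shift□-fill c A B) (shift□-fill c C B)
shift□-fill c □         B = refl

fill-assoc : ∀ A B C → fill (fill A B) C ≡ fill A (fill B C)
fill-assoc (var x)   B C = refl
fill-assoc (lam A)   B C =
  cong lam (trans (fill-assoc A (shift□ zero B) (shift□ zero C))
                  (cong (fill A) (sym (shift□-fill zero B C))))
fill-assoc (app A D) B C = cong₂ app (fill-assoc A B C) (fill-assoc D B C)
fill-assoc □         B C = refl

boxVar-shift□-cancel : ∀ c X → boxVar c (shift□ c X) ≡ X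
boxVar-shift□-cancel c (var n) with n <? c
... | yes n<c rewrite shift□-var-< n<c | boxVar-var-< n<c = refl
... | no n≮c  rewrite shift□-var-≥ (≮⇒≥ n≮c) | boxVar-var-> (≮⇒≥ n≮c) = refl
boxVar-shift□-cancel c (lam X)   = cong lam (boxVar-shift□-cancel (suc c) X)
boxVar-shift□-cancel c (app X Y) = cong₂ app (boxVar-shift□-cancel c X) (boxVar-shift□-cancel c Y)
boxVar-shift□-cancel c □         = refl

boxVar-shift□-below : ∀ d c U → d ≤ c → boxVar (suc c) (shift□ d U) ≡ shift□ d (boxVar c U)
boxVar-shift□-below d c (var n) d≤c with <-cmp n c
... | tri< n<c _ _ with n <? d
...   | yes n<d
  rewrite boxVar-var-< n<c | shift□-var-< n<d | boxVar-var-< (m≤n⇒m≤1+n n<c) = refl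
...   | no n≮d
  rewrite boxVar-var-< n<c | shift□-var-≥ (≮⇒≥ n≮d) | boxVar-var-< (s≤s n<c) = refl
boxVar-shift□-below d c (var n) d≤c | tri≈ _ refl _
  rewrite boxVar-var-≡ c | shift□-var-≥ d≤c | boxVar-var-≡ (suc c) = refl
boxVar-shift□-below d c (var n) d≤c | tri> _ _ (s≤s c≤m)
  rewrite boxVar-var-> c≤m | shift□-var-≥ (≤-trans d≤c c≤m)
        | shift□-var-≥ (m≤n⇒m≤1+n (≤-trans d≤c c≤m)) | boxVar-var-> (s≤s c≤m) = refl
boxVar-shift□-below d c (lam U)   d≤c = cong lam (boxVar-shift□-below (suc d) (suc c) U (s≤s d≤c))
boxVar-shift□-below d c (app U V) d≤c =
  cong₂ app (boxVar-shift□-below d c U d≤c) (boxVar-shift□-below d c V d≤c)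
boxVar-shift□-below d c □         d≤c = refl

boxVar-shift□-above : ∀ d c U → d ≤ c → boxVar d (shift□ (suc c) U) ≡ shift□ c (boxVar d U)
boxVar-shift□-above d c (var n) d≤c with <-cmp n d
... | tri< n<d _ _
  rewrite shift□-var-< (≤-trans n<d (m≤n⇒m≤1+n d≤c)) | boxVar-var-< n<d
        | shift□-var-< (≤-trans n<d d≤c) = refl
... | tri≈ _ refl _ rewrite shift□-var-< (s≤s d≤c) | boxVar-var-≡ d = refl
... | tri> _ _ (s≤s {n = m} d≤m) with m <? c
...   | yes m<c
  rewrite shift□-var-< (s≤s m<c) | boxVar-var-> d≤m | shift□-var-< m<c = refl
...   | no m≮c
  rewrite shift□-var-≥ (s≤s (≮⇒≥ m≮c)) | boxVar-var-> (m≤n⇒m≤1+n d≤m)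
        | boxVar-var-> d≤m | shift□-var-≥ (≮⇒≥ m≮c) = refl
boxVar-shift□-above d c (lam U)   d≤c = cong lam (boxVar-shift□-above (suc d) (suc c) U (s≤s d≤c))
boxVar-shift□-above d c (app U V) d≤c =
  cong₂ app (boxVar-shift□-above d c U d≤c) (boxVar-shift□-above d c V d≤c)
boxVar-shift□-above d c □         d≤c = refl

boxVar-fill-shift□ : ∀ c S U → boxVar c (fill (shift□ c S) U) ≡ fill S (boxVar c U)
boxVar-fill-shift□ c (var n) U with n <? c
... | yes n<c rewrite shift□-var-< n<c | boxVar-var-< n<c = refl
... | no n≮c  rewrite shift□-var-≥ (≮⇒≥ n≮c) | boxVar-var-> (≮⇒≥ n≮c) = refl
boxVar-fill-shift□ c (lam S) U =
  cong lam (trans (boxVar-fill-shift□ (suc c) S (shift□ zero U))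
                  (cong (fill S) (boxVar-shift□-below zero c U z≤n)))
boxVar-fill-shift□ c (app S T) U = cong₂ app (boxVar-fill-shift□ c S U) (boxVar-fill-shift□ c T U)
boxVar-fill-shift□ c □         U = refl

kP-shiftP : ∀ c p → kP (shiftP c p) ≡ shiftP c (kP p)
kP-shiftP c (pv n) with n <ᵇ c
... | true  = refl
... | false = refl
kP-shiftP c (λxk u) = refl
kP-shiftP c (λk u)  = refl

mutual
  kT-shiftT : ∀ c t → kT (shiftT c t) ≡ shiftT c (kT t)
  kT-shiftT c *         = refl
  kT-shiftT c k         = refl
  kT-shiftT c ⟨ p , t ⟩ = cong₂ ⟨_,_⟩ (kP-shiftP c p) (kT-shiftT c t)
  kT-shiftT c (λx u)    = cong λx (kE-shiftE (suc c) u)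

  kE-shiftE : ∀ c u → kE (shiftE c u) ≡ shiftE c (kE u)
  kE-shiftE c (t ⨾ p)      = cong₂ _⨾_ (kT-shiftT c t) (kP-shiftP c p)
  kE-shiftE c (λ̄k u ＠ t) = cong (λ̄k (shiftE c u) ＠_) (kT-shiftT c t)

cast-⇓T : ∀ {t T₁ T₂} → T₁ ≡ T₂ → ⌊ t ⌋T⇓ T₁ → ⌊ t ⌋T⇓ T₂
cast-⇓T refl d = d

cast-⇓E : ∀ {u U₁ U₂} → U₁ ≡ U₂ → ⌊ u ⌋E⇓ U₁ → ⌊ u ⌋E⇓ U₂
cast-⇓E refl d = d

kP-⇓ : ∀ {p P′} → ⌊ p ⌋P⇓ P′ → ⌊ kP p ⌋P⇓ P′
kP-⇓ rb-var     = rb-var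
kP-⇓ (rb-λxk d) = rb-λxk d
kP-⇓ (rb-λk d)  = rb-λk d

kQ-⇓ : ∀ {q Q′} → ⌊ q ⌋Q⇓ Q′ → ⌊ kQ q ⌋Q⇓ Q′
kQ-⇓ (rb-λ̄k d) = rb-λ̄k d

mutual
  shiftP-⇓ : ∀ c {p P′} → ⌊ p ⌋P⇓ P′ → ⌊ shiftP c p ⌋P⇓ shift□ c P′
  shiftP-⇓ c {pv n} rb-var with n <ᵇ c
  ... | true  = rb-var
  ... | false = rb-var
  shiftP-⇓ c (rb-λxk {u} d) =
    rb-λxk (subst (⌊_⌋E⇓ _) (sym (kE-shiftE (suc c) u)) (shiftE-⇓ (suc c) d))
  shiftP-⇓ c (rb-λk {u} d) =
    rb-λk (subst (⌊_⌋E⇓ _) (sym (kE-shiftE c u)) (shiftE-⇓ c d))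

  shiftT-⇓ : ∀ c {t T′} → ⌊ t ⌋T⇓ T′ → ⌊ shiftT c t ⌋T⇓ shift□ c T′
  shiftT-⇓ c rb-* = rb-*
  shiftT-⇓ c (rb-pair {P' = P′} {T' = T′} dt dp) =
    cast-⇓T (sym (shift□-fill c T′ (app □ P′))) (rb-pair (shiftT-⇓ c dt) (shiftP-⇓ c dp))
  shiftT-⇓ c (rb-λx {U = U} d) =
    cast-⇓T (boxVar-shift□-above zero c U z≤n) (rb-λx (shiftE-⇓ (suc c) d))

  shiftQ-⇓ : ∀ c {q Q′} → ⌊ q ⌋Q⇓ Q′ → ⌊ shiftQ c q ⌋Q⇓ shift□ c Q′
  shiftQ-⇓ c (rb-λ̄k {u} d) =
    rb-λ̄k (subst (⌊_⌋E⇓ _) (sym (kE-shiftE c u)) (shiftE-⇓ c d))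

  shiftE-⇓ : ∀ c {u U} → ⌊ u ⌋E⇓ U → ⌊ shiftE c u ⌋E⇓ shift□ c U
  shiftE-⇓ c (rb-semi {T' = T′} {P' = P′} dt dp) =
    cast-⇓E (sym (shift□-fill c T′ P′)) (rb-semi (shiftT-⇓ c dt) (shiftP-⇓ c dp))
  shiftE-⇓ c (rb-app {Q' = Q′} {T' = T′} dt dq) =
    cast-⇓E (sym (shift□-fill c T′ Q′)) (rb-app (shiftT-⇓ c dt) (shiftQ-⇓ c dq))

mutual
  data StarFreeP : P → Set where
    sf-pv  : ∀ n → StarFreeP (pv n)
    sf-λxk : ∀ {u} → StarFreeE u → StarFreeP (λxk u)
    sf-λk  : ∀ {u} → StarFreeE u → StarFreeP (λk u)

  data StarFreeT : T → Set where
    sf-k    : StarFreeT k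
    sf-pair : ∀ {p t} → StarFreeP p → StarFreeT t → StarFreeT ⟨ p , t ⟩
    sf-λx   : ∀ {u} → StarFreeE u → StarFreeT (λx u)

  data StarFreeQ : Q → Set where
    sf-λ̄k : ∀ {u} → StarFreeE u → StarFreeQ (λ̄k u)

  data StarFreeE : E → Set where
    sf-semi : ∀ {t p} → StarFreeT t → StarFreeP p → StarFreeE (t ⨾ p)
    sf-app  : ∀ {q t} → StarFreeQ q → StarFreeT t → StarFreeE (q ＠ t)

-- * occurs exactly once, and never inside a p- or q-term: on such terms
-- starT/starE is the ptq-counterpart of fill.
mutual
  data LinearT : T → Set where
    lin-*    : LinearT *
    lin-pair : ∀ {p t} → StarFreeP p → LinearT t → LinearT ⟨ p , t ⟩
    lin-λx   : ∀ {u} → LinearE u → LinearT (λx u)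

  data LinearE : E → Set where
    lin-semi : ∀ {t p} → LinearT t → StarFreeP p → LinearE (t ⨾ p)
    lin-app  : ∀ {q t} → StarFreeQ q → LinearT t → LinearE (q ＠ t)

mutual
  starP-starFree : ∀ s {p} → StarFreeP p → starP s p ≡ p
  starP-starFree s (sf-pv n)  = refl
  starP-starFree s (sf-λxk u) = cong λxk (starE-starFree (shiftT zero s) u)
  starP-starFree s (sf-λk u)  = cong λk (starE-starFree s u)

  starT-starFree : ∀ s {t} → StarFreeT t → starT s t ≡ t
  starT-starFree s sf-k          = refl
  starT-starFree s (sf-pair p t) = cong₂ ⟨_,_⟩ (starP-starFree s p) (starT-starFree s t)
  starT-starFree s (sf-λx u)     = cong λx (starE-starFree (shiftT zero s) u)

  starQ-starFree : ∀ s {q} → StarFreeQ q → starQ s q ≡ q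
  starQ-starFree s (sf-λ̄k u) = cong λ̄k (starE-starFree s u)

  starE-starFree : ∀ s {u} → StarFreeE u → starE s u ≡ u
  starE-starFree s (sf-semi t p) = cong₂ _⨾_ (starT-starFree s t) (starP-starFree s p)
  starE-starFree s (sf-app q t)  = cong₂ _＠_ (starQ-starFree s q) (starT-starFree s t)

mutual
  starFree-shiftP : ∀ c {p} → StarFreeP p → StarFreeP (shiftP c p)
  starFree-shiftP c (sf-pv n) with n <ᵇ c
  ... | true  = sf-pv n
  ... | false = sf-pv (suc n)
  starFree-shiftP c (sf-λxk u) = sf-λxk (starFree-shiftE (suc c) u)
  starFree-shiftP c (sf-λk u)  = sf-λk (starFree-shiftE c u)

  starFree-shiftT : ∀ c {t} → StarFreeT t → StarFreeT (shiftT c t)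
  starFree-shiftT c sf-k          = sf-k
  starFree-shiftT c (sf-pair p t) = sf-pair (starFree-shiftP c p) (starFree-shiftT c t)
  starFree-shiftT c (sf-λx u)     = sf-λx (starFree-shiftE (suc c) u)

  starFree-shiftQ : ∀ c {q} → StarFreeQ q → StarFreeQ (shiftQ c q)
  starFree-shiftQ c (sf-λ̄k u) = sf-λ̄k (starFree-shiftE c u)

  starFree-shiftE : ∀ c {u} → StarFreeE u → StarFreeE (shiftE c u)
  starFree-shiftE c (sf-semi t p) = sf-semi (starFree-shiftT c t) (starFree-shiftP c p)
  starFree-shiftE c (sf-app q t)  = sf-app (starFree-shiftQ c q) (starFree-shiftT c t)

mutual
  linear-shiftT : ∀ c {t} → LinearT t → LinearT (shiftT c t)
  linear-shiftT c lin-*          = lin-*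
  linear-shiftT c (lin-pair p t) = lin-pair (starFree-shiftP c p) (linear-shiftT c t)
  linear-shiftT c (lin-λx u)     = lin-λx (linear-shiftE (suc c) u)

  linear-shiftE : ∀ c {u} → LinearE u → LinearE (shiftE c u)
  linear-shiftE c (lin-semi t p) = lin-semi (linear-shiftT c t) (starFree-shiftP c p)
  linear-shiftE c (lin-app q t)  = lin-app (starFree-shiftQ c q) (linear-shiftT c t)

mutual
  linear-starT : ∀ {s} → LinearT s → ∀ {t} → LinearT t → LinearT (starT s t)
  linear-starT ls lin-* = ls
  linear-starT {s} ls (lin-pair p t) rewrite starP-starFree s p = lin-pair p (linear-starT ls t)
  linear-starT ls (lin-λx u) = lin-λx (linear-starE (linear-shiftT zero ls) u)

  linear-starE : ∀ {s} → LinearT s → ∀ {u} → LinearE u → LinearE (starE s u)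
  linear-starE {s} ls (lin-semi t p) rewrite starP-starFree s p = lin-semi (linear-starT ls t) p
  linear-starE {s} ls (lin-app q t)  rewrite starQ-starFree s q = lin-app q (linear-starT ls t)

mutual
  starT-⇓ : ∀ {s S} → ⌊ s ⌋T⇓ S → ∀ {t T′} → LinearT t → ⌊ t ⌋T⇓ T′ →
            ⌊ starT s t ⌋T⇓ fill S T′
  starT-⇓ {S = S} ds lin-* rb-* = cast-⇓T (sym (fill-identityʳ S)) ds
  starT-⇓ {s} {S} ds (lin-pair p t) (rb-pair {P' = P′} {T' = T′} dt dp)
    rewrite starP-starFree s p = cast-⇓T (fill-assoc S T′ (app □ P′)) (rb-pair (starT-⇓ ds t dt) dp)
  starT-⇓ {S = S} ds (lin-λx u) (rb-λx {U = U} du) =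
    cast-⇓T (boxVar-fill-shift□ zero S U) (rb-λx (starE-⇓ (shiftT-⇓ zero ds) u du))

  starE-⇓ : ∀ {s S} → ⌊ s ⌋T⇓ S → ∀ {u U} → LinearE u → ⌊ u ⌋E⇓ U →
            ⌊ starE s u ⌋E⇓ fill S U
  starE-⇓ {s} {S} ds (lin-semi t p) (rb-semi {T' = T′} {P' = P′} dt dp)
    rewrite starP-starFree s p = cast-⇓E (fill-assoc S T′ P′) (rb-semi (starT-⇓ ds t dt) dp)
  starE-⇓ {s} {S} ds (lin-app q t) (rb-app {Q' = Q′} {T' = T′} dt dq)
    rewrite starQ-starFree s q = cast-⇓E (fill-assoc S T′ Q′) (rb-app (starT-⇓ ds t dt) dq)

starFree-ⁿ : ∀ M → StarFreeP (M ⁿ)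
starFree-ⁿ (var x)   = sf-pv x
starFree-ⁿ (lam M)   = sf-λxk (sf-semi sf-k (starFree-ⁿ M))
starFree-ⁿ (app M N) = sf-λk (sf-semi (sf-pair (starFree-ⁿ N) sf-k) (starFree-ⁿ M))

starFree-ᵛ : ∀ M → StarFreeQ (M ᵛ)
starFree-ᵛ (var x)   = sf-λ̄k (sf-semi sf-k (sf-pv x))
starFree-ᵛ (lam M)   = sf-λ̄k (sf-semi sf-k (sf-λxk (sf-app (starFree-ᵛ M) sf-k)))
starFree-ᵛ (app M N) =
  sf-λ̄k (sf-app (starFree-ᵛ N)
    (sf-λx (sf-app (starFree-shiftQ zero (starFree-ᵛ M)) (sf-pair (sf-pv zero) sf-k))))

starFree-barᵛ : ∀ V (v : Value V) → StarFreeP (barᵛ V v)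
starFree-barᵛ _ (var x) = sf-pv x
starFree-barᵛ _ (lam M) = sf-λxk (sf-app (starFree-ᵛ M) sf-k)

ⁿ-⇓ : ∀ M → ⌊ M ⁿ ⌋P⇓ ι M
ⁿ-⇓ (var x)   = rb-var
ⁿ-⇓ (lam M)   = rb-λxk (rb-semi rb-* (kP-⇓ (ⁿ-⇓ M)))
ⁿ-⇓ (app M N) =
  rb-λk (cast-⇓E (cong (app (ι M)) (fill-ι N (ι M)))
    (rb-semi (rb-pair rb-* (kP-⇓ (ⁿ-⇓ N))) (kP-⇓ (ⁿ-⇓ M))))

-- Used with q the translation M ᵛ shifted past the new binder x.
continuation-⇓ : ∀ {q Q} → ⌊ q ⌋Q⇓ shift□ zero Q →
                 ⌊ λx (q ＠ ⟨ pv zero , * ⟩) ⌋T⇓ app Q □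
continuation-⇓ {Q = Q} d =
  cast-⇓T (cong (λ X → app X □) (boxVar-shift□-cancel zero Q))
    (rb-λx (rb-app (rb-pair rb-* rb-var) d))

ᵛ-⇓ : ∀ M → ⌊ M ᵛ ⌋Q⇓ ι M
ᵛ-⇓ (var x)   = rb-λ̄k (rb-semi rb-* rb-var)
ᵛ-⇓ (lam M)   = rb-λ̄k (rb-semi rb-* (rb-λxk (rb-app rb-* (kQ-⇓ (ᵛ-⇓ M)))))
ᵛ-⇓ (app M N) =
  rb-λ̄k (cast-⇓E (cong (λ X → app X (ι N)) (fill-ι M (ι N)))
    (rb-app (continuation-⇓ (kQ-⇓ (shiftQ-⇓ zero (ᵛ-⇓ M)))) (kQ-⇓ (ᵛ-⇓ N))))

barᵛ-⇓ : ∀ V (v : Value V) → ⌊ barᵛ V v ⌋P⇓ ι V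
barᵛ-⇓ _ (var x) = rb-var
barᵛ-⇓ _ (lam M) = rb-λxk (rb-app rb-* (kQ-⇓ (ᵛ-⇓ M)))

linear-hatⁿ : ∀ M → LinearE (hatⁿ M)
linear-hatⁿ (var x)   = lin-semi lin-* (sf-pv x)
linear-hatⁿ (lam M)   = lin-semi lin-* (starFree-ⁿ (lam M))
linear-hatⁿ (app M N) = linear-starE (lin-pair (starFree-ⁿ N) lin-*) (linear-hatⁿ M)

hatⁿ-⇓ : ∀ M → ⌊ hatⁿ M ⌋E⇓ ι M
hatⁿ-⇓ (var x)   = rb-semi rb-* rb-var
hatⁿ-⇓ (lam M)   = rb-semi rb-* (ⁿ-⇓ (lam M))
hatⁿ-⇓ (app M N) =
  cast-⇓E (cong (app (ι M)) (fill-ι N (ι M)))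
    (starE-⇓ (rb-pair rb-* (ⁿ-⇓ N)) (linear-hatⁿ M) (hatⁿ-⇓ M))

linear-hatᵛ : ∀ M → LinearE (hatᵛ M)
linear-hatᵛ (var x)   = lin-semi lin-* (sf-pv x)
linear-hatᵛ (lam M)   = lin-semi lin-* (starFree-barᵛ _ (lam M))
linear-hatᵛ (app M (var x))     = linear-starE (lin-pair (sf-pv x) lin-*) (linear-hatᵛ M)
linear-hatᵛ (app M (lam N))     =
  linear-starE (lin-pair (starFree-barᵛ _ (lam N)) lin-*) (linear-hatᵛ M)
linear-hatᵛ (app M (app N₁ N₂)) =
  linear-starE (lin-λx (lin-app (starFree-shiftQ zero (starFree-ᵛ M)) (lin-pair (sf-pv zero) lin-*)))
               (linear-hatᵛ (app N₁ N₂))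

hatᵛ-⇓ : ∀ M → ⌊ hatᵛ M ⌋E⇓ ι M
hatᵛ-⇓ (var x)   = rb-semi rb-* rb-var
hatᵛ-⇓ (lam M)   = rb-semi rb-* (barᵛ-⇓ _ (lam M))
hatᵛ-⇓ (app M (var x))     = starE-⇓ (rb-pair rb-* rb-var) (linear-hatᵛ M) (hatᵛ-⇓ M)
hatᵛ-⇓ (app M (lam N))     =
  cast-⇓E (cong (app (ι M)) (fill-ι (lam N) (ι M)))
    (starE-⇓ (rb-pair rb-* (barᵛ-⇓ _ (lam N))) (linear-hatᵛ M) (hatᵛ-⇓ M))
hatᵛ-⇓ (app M (app N₁ N₂)) =
  cast-⇓E (cong (λ X → app X (ι (app N₁ N₂))) (fill-ι M (ι (app N₁ N₂))))
    (starE-⇓ (continuation-⇓ (shiftQ-⇓ zero (ᵛ-⇓ M)))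
             (linear-hatᵛ (app N₁ N₂)) (hatᵛ-⇓ (app N₁ N₂)))

proposition7 : (M : Λ) → SimplyTyped M →
    (⌊ * ⨾ (M ⁿ) ⌋E⇓ ι M × ⌊ hatⁿ M ⌋E⇓ ι M × ⌊ M ⁿ ⌋P⇓ ι M)
    × (⌊ (M ᵛ) ＠ * ⌋E⇓ ι M × ⌊ hatᵛ M ⌋E⇓ ι M × ⌊ M ᵛ ⌋Q⇓ ι M)
proposition7 M _ =
  (rb-semi rb-* (ⁿ-⇓ M) , hatⁿ-⇓ M , ⁿ-⇓ M) , (rb-app rb-* (ᵛ-⇓ M) , hatᵛ-⇓ M , ᵛ-⇓ M)
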